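{- Let $k\ge 0$ be an integer. For every positive integer $n$, $S^{(k)}_n-R_k(n-k-2)-R_k(n-1)=1$.
   Context: The $k$-Skipponacci numbers are defined by $S^{(k)}_n=0$ for $n\le 0$, $S^{(k)}_i=i$ for $1\le i\le k+1$, and $S^{(k)}_{n+1}=S^{(k)}_n+S^{(k)}_{n-k}$ for $n\ge k+1$. $R_k(n)=\sum_{b\ge0,\ n-b(2k+2)>0}S^{(k)}_{n-b(2k+2)}=S^{(k)}_n+S^{(k)}_{n-2k-2}+S^{(k)}_{n-4k-4}+\cdots$ for $n>0$, and $R_k(n)=0$ for $n\le 0$. -}

module Defs where

open import Data.Nat using (ℕ; zero; suc; _+_; _*_; _∸_; _≤ᵇ_)
open import Data.Bool using (if_then_else_)

-- Indices are natural numbers; the paper's S_n = 0 for n ≤ 0 corresponds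
-- to S 0 = 0 here, and negative indices n - c are rendered by truncated
-- subtraction n ∸ c (which lands on index 0, where everything is 0).

-- Fuel-driven evaluation of the k-Skipponacci recurrence.
-- With fuel ≥ m the result is S^{(k)}_m.
skipF : ℕ → ℕ → ℕ → ℕ
skipF k zero    m       = 0
skipF k (suc f) zero    = 0
skipF k (suc f) (suc n) =
  if suc n ≤ᵇ suc k then suc n
  else skipF k f n + skipF k f (n ∸ k)

-- S^{(k)}_m :  S 0 = 0,  S i = i (1 ≤ i ≤ k+1),
--              S (n+1) = S n + S (n - k)  for n ≥ k+1.
S : ℕ → ℕ → ℕ
S k m = skipF k m m

-- R_k(m) = S_m + S_{m-(2k+2)} + S_{m-2(2k+2)} + ... (positive indices only);
-- R_k(0) = 0.
RF : ℕ → ℕ → ℕ → ℕ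
RF k zero    m       = 0
RF k (suc f) zero    = 0
RF k (suc f) (suc n) = S k (suc n) + RF k f (suc n ∸ (2 * k + 2))

R : ℕ → ℕ → ℕ
R k m = RF k m m

module Submission where

-- The theorem then follows by strong induction on n.  For n ≤ k every term
-- is an initial value: S (n+1) = n+1, R 0 = 0, R n = n.  For n = k+1+j the
-- recurrence gives S (k+j+2) = S (k+j+1) + S (j+1); the induction
-- hypothesis at j rewrites S (j+1) as 1 + R (j+1-k-2) + R j, and
-- S (k+j+1) + R (j+1-k-2) regroups into R (k+j+1) by the unfolding of R,
-- since k+j+1 - (2k+2) = j+1 - (k+2).

open import Defs
open import Data.Nat using (ℕ; zero; suc; _+_; _*_; _∸_; _≤_; _<_; _≤ᵇ_; s≤s; _≤?_)
open import Data.Nat.Properties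
open import Data.Bool using (if_then_else_)
open import Data.Nat.Induction using (<-rec)
open import Data.Product using (_,_)
open import Relation.Nullary using (yes; no)
open import Relation.Nullary.Reflects using (ofʸ; ofⁿ)
open import Relation.Nullary.Negation using (contradiction)
open import Relation.Binary.PropositionalEquality
open import Data.Nat.Tactic.RingSolver using (solve-∀)
open ≡-Reasoning

skipF-fuel : ∀ k f g m → m ≤ f → m ≤ g → skipF k f m ≡ skipF k g m
skipF-fuel k zero    zero    zero    _       _       = refl
skipF-fuel k zero    (suc g) zero    _       _       = refl
skipF-fuel k (suc f) zero    zero    _       _       = refl
skipF-fuel k (suc f) (suc g) zero    _       _       = refl
skipF-fuel k (suc f) (suc g) (suc n) (s≤s p) (s≤s q) =
  cong₂ (λ a b → if suc n ≤ᵇ suc k then suc n else a + b)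
    (skipF-fuel k f g n p q)
    (skipF-fuel k f g (n ∸ k) (≤-trans (m∸n≤m n k) p) (≤-trans (m∸n≤m n k) q))

S-initial : ∀ k n → n ≤ k → S k (suc n) ≡ suc n
S-initial k n n≤k with suc n ≤ᵇ suc k | ≤ᵇ-reflects-≤ (suc n) (suc k)
... | _ | ofʸ _    = refl
... | _ | ofⁿ n≰k = contradiction (s≤s n≤k) n≰k

S-recurrence : ∀ k n → k < n → S k (suc n) ≡ S k n + S k (n ∸ k)
S-recurrence k n k<n with suc n ≤ᵇ suc k | ≤ᵇ-reflects-≤ (suc n) (suc k)
... | _ | ofʸ n≤k = contradiction (≤-pred n≤k) (<⇒≱ k<n)
... | _ | ofⁿ _   =
  cong (skipF k n n +_) (skipF-fuel k n (n ∸ k) (n ∸ k) (m∸n≤m n k) ≤-refl)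

-- One period step never increases a positive index beyond its predecessor,
-- so the fuel of RF stays sufficient in the recursive call.
period-step-≤ : ∀ k n → suc n ∸ (2 * k + 2) ≤ n
period-step-≤ k n rewrite +-comm (2 * k) 2 = m∸n≤m n (suc (2 * k))

RF-fuel : ∀ k f g m → m ≤ f → m ≤ g → RF k f m ≡ RF k g m
RF-fuel k zero    zero    zero    _       _       = refl
RF-fuel k zero    (suc g) zero    _       _       = refl
RF-fuel k (suc f) zero    zero    _       _       = refl
RF-fuel k (suc f) (suc g) zero    _       _       = refl
RF-fuel k (suc f) (suc g) (suc n) (s≤s p) (s≤s q) =
  cong (S k (suc n) +_)
    (RF-fuel k f g _ (≤-trans (period-step-≤ k n) p) (≤-trans (period-step-≤ k n) q))

R-unfold : ∀ k n → R k (suc n) ≡ S k (suc n) + R k (suc n ∸ (2 * k + 2))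
R-unfold k n = cong (S k (suc n) +_) (RF-fuel k n _ _ (period-step-≤ k n) ≤-refl)

two-periods : ∀ k → suc k + suc k ≡ 2 * k + 2
two-periods = solve-∀

R-initial : ∀ k n → n ≤ suc k → R k n ≡ n
R-initial k zero    _   = refl
R-initial k (suc n) n<k =
  begin
    R k (suc n)
  ≡⟨ R-unfold k n ⟩
    S k (suc n) + R k (suc n ∸ (2 * k + 2))
  ≡⟨ cong₂ (λ a m → a + R k m) (S-initial k n (≤-pred n<k)) (m≤n⇒m∸n≡0 n<2k+2) ⟩
    suc n + 0
  ≡⟨ +-identityʳ (suc n) ⟩
    suc n
  ∎
  where
  n<2k+2 : suc n ≤ 2 * k + 2
  n<2k+2 = ≤-trans n<k (≤-trans (m≤m+n (suc k) (suc k)) (≤-reflexive (two-periods k)))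

shift-index : ∀ k j → suc (suc (k + j)) ∸ (k + 2) ≡ j
shift-index k j rewrite +-comm k 2 = m+n∸m≡n k j

skip-index : ∀ k j → suc (k + j) ∸ k ≡ suc j
skip-index k j rewrite sym (+-suc k j) = m+n∸m≡n k (suc j)

period-index : ∀ k j → suc (k + j) ∸ (2 * k + 2) ≡ suc j ∸ (k + 2)
period-index k j =
  begin
    suc (k + j) ∸ (2 * k + 2)
  ≡⟨ cong₂ _∸_ (sym (+-suc k j)) (period-split k) ⟩
    (k + suc j) ∸ (k + (k + 2))
  ≡⟨ [m+n]∸[m+o]≡n∸o k (suc j) (k + 2) ⟩
    suc j ∸ (k + 2)
  ∎
  where
  period-split : ∀ k → 2 * k + 2 ≡ k + (k + 2)
  period-split = solve-∀

Identity : ℕ → ℕ → Set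
Identity k n = S k (suc n) ≡ 1 + R k (suc n ∸ (k + 2)) + R k (suc n ∸ 1)

identity-initial : ∀ k n → n ≤ k → Identity k n
identity-initial k n n≤k =
  begin
    S k (suc n)
  ≡⟨ S-initial k n n≤k ⟩
    1 + 0 + n
  ≡⟨ cong₂ (λ m r → 1 + R k m + r)
       (sym (m≤n⇒m∸n≡0 (≤-trans (s≤s n≤k) (≤-trans (n≤1+n (suc k)) (≤-reflexive (+-comm 2 k))))))
       (sym (R-initial k n (m≤n⇒m≤1+n n≤k))) ⟩
    1 + R k (suc n ∸ (k + 2)) + R k n
  ∎

identity-step : ∀ k j → Identity k j → Identity k (suc (k + j))
identity-step k j ih =
  begin
    S k (suc (suc (k + j)))
  ≡⟨ S-recurrence k (suc (k + j)) (s≤s (m≤m+n k j)) ⟩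
    S k (suc (k + j)) + S k (suc (k + j) ∸ k)
  ≡⟨ cong (λ m → S k (suc (k + j)) + S k m) (skip-index k j) ⟩
    S k (suc (k + j)) + S k (suc j)
  ≡⟨ cong (S k (suc (k + j)) +_) ih ⟩
    S k (suc (k + j)) + (1 + R k (suc j ∸ (k + 2)) + R k j)
  ≡⟨ regroup (S k (suc (k + j))) (R k (suc j ∸ (k + 2))) (R k j) ⟩
    1 + R k j + (S k (suc (k + j)) + R k (suc j ∸ (k + 2)))
  ≡⟨ cong (λ m → 1 + R k j + (S k (suc (k + j)) + R k m)) (sym (period-index k j)) ⟩
    1 + R k j + (S k (suc (k + j)) + R k (suc (k + j) ∸ (2 * k + 2)))
  ≡⟨ cong₂ (λ m r → 1 + R k m + r) (sym (shift-index k j)) (sym (R-unfold k (k + j))) ⟩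
    1 + R k (suc (suc (k + j)) ∸ (k + 2)) + R k (suc (k + j))
  ∎
  where
  regroup : ∀ a b c → a + (1 + b + c) ≡ 1 + c + (a + b)
  regroup = solve-∀

lemma2p1 : (k n : ℕ) → S k (suc n) ≡ 1 + R k (suc n ∸ (k + 2)) + R k (suc n ∸ 1)
lemma2p1 k = <-rec (Identity k) step
  where
  step : ∀ n → (∀ {j} → j < n → Identity k j) → Identity k n
  step n ih with n ≤? k
  ... | yes n≤k = identity-initial k n n≤k
  ... | no  n≰k with m≤n⇒∃[o]m+o≡n (≰⇒> n≰k)
  ... | j , refl = identity-step k j (ih (s≤s (m≤n+m j k)))
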